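{- For all integers $n\ge1$ and $p\ge0$, $$\mathcal{A}(K_n\cup pK_1)=\frac{\displaystyle\sum_{k=n}^{n+p}k\sum_{j=0}^{n}\binom{k-j}{n-j}\binom{n}{j}(n-j)!\,{p \brace k-j}}{\displaystyle\sum_{k=n}^{n+p}\sum_{j=0}^{n}\binom{k-j}{n-j}\binom{n}{j}(n-j)!\,{p \brace k-j}}.$$
   Context: All graphs are finite, simple and undirected. A coloring of a graph $G$ assigns colors to its vertices so that adjacent vertices receive different colors; two colorings are equivalent if they induce the same partition of the vertex set into color classes. $S(G,k)$ denotes the number of non-equivalent colorings of $G$ using exactly $k$ colors. Set $\mathcal{B}(G)=\sum_{k\ge1}S(G,k)$, $\mathcal{T}(G)=\sum_{k\ge1}kS(G,k)$ and $\mathcal{A}(G)=\mathcal{T}(G)/\mathcal{B}(G)$. $K_n\cup pK_1$ is the disjoint union of the complete graph $K_n$ and $p$ isolated vertices. ${a \brace b}$ is the Stirling number of the second kind (number of partitions of an $a$-set into $b$ nonempty blocks), with ${0\brace 0}=1$ and ${a\brace b}=0$ if $b<0$ or $b>a$ or ($b=0<a$). -}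

module Defs where

open import Data.Nat using (ℕ; zero; suc; _+_; _*_; _∸_; _≤ᵇ_; _<ᵇ_; _≡ᵇ_; _!)
open import Data.Nat.ListAction using (sum)
open import Data.Bool.ListAction using (all; any)
open import Data.Nat.Combinatorics using (_C_)
open import Data.Bool using (Bool; true; false; _∧_; _∨_; not; if_then_else_)
open import Data.Bool.Properties using (∧-comm; ∧-zeroʳ)
open import Data.Fin using (Fin; toℕ)
import Data.Fin as Fin
open import Data.Vec using (Vec; []; _∷_; lookup; toList)
open import Data.List using (List; []; _∷_; [_]; map; concatMap; length; filterᵇ; upTo; allFin)
open import Data.Integer using (+_)
open import Data.Rational using (ℚ; 0ℚ; _/_)
open import Relation.Nullary.Decidable using (⌊_⌋)
open import Relation.Binary.PropositionalEquality using (_≡_; refl; cong)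

record Graph : Set where
  field
    V     : ℕ
    adj   : Fin V → Fin V → Bool
    sym   : ∀ i j → adj i j ≡ adj j i
    irrefl : ∀ i → adj i i ≡ false
open Graph public

private
  ≡ᵇ-refl : ∀ m → (m ≡ᵇ m) ≡ true
  ≡ᵇ-refl zero = refl
  ≡ᵇ-refl (suc m) = ≡ᵇ-refl m

  ≡ᵇ-sym : ∀ m k → (m ≡ᵇ k) ≡ (k ≡ᵇ m)
  ≡ᵇ-sym zero zero = refl
  ≡ᵇ-sym zero (suc k) = refl
  ≡ᵇ-sym (suc m) zero = refl
  ≡ᵇ-sym (suc m) (suc k) = ≡ᵇ-sym m k

cliqueAdj : (n p : ℕ) → Fin (n + p) → Fin (n + p) → Bool
cliqueAdj n p i j = ((toℕ i <ᵇ n) ∧ (toℕ j <ᵇ n)) ∧ not (toℕ i ≡ᵇ toℕ j)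

KnUpK1 : ℕ → ℕ → Graph
KnUpK1 n p = record
  { V = n + p
  ; adj = cliqueAdj n p
  ; sym = λ i j → cong₂' (∧-comm (toℕ i <ᵇ n) (toℕ j <ᵇ n)) (cong not (≡ᵇ-sym (toℕ i) (toℕ j)))
  ; irrefl = λ i → irr i
  }
  where
  cong₂' : ∀ {a b c d : Bool} → a ≡ b → c ≡ d → (a ∧ c) ≡ (b ∧ d)
  cong₂' refl refl = refl
  irr : ∀ i → cliqueAdj n p i i ≡ false
  irr i with toℕ i ≡ᵇ toℕ i | ≡ᵇ-refl (toℕ i)
  ... | true | refl = ∧-zeroʳ _

-- Colorings with exactly k colors, up to equivalence (same partition
-- into color classes).  Each equivalence class of colorings using exactly the k
-- colors contains exactly one "canonical" representative: the one in which
-- colors appear for the first time in increasing order 0,1,2,...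
-- (restricted growth string).  S G k counts these canonical
-- representatives, i.e. the number of partitions of V(G) into k nonempty
-- independent color classes.

allColorings : (k v : ℕ) → List (Vec (Fin k) v)
allColorings k zero = [ [] ]
allColorings k (suc v) = concatMap (λ x → map (x ∷_) (allColorings k v)) (allFin k)

module _ (G : Graph) {k : ℕ} (c : Vec (Fin k) (V G)) where
  isProper : Bool
  isProper = all (λ i → all (λ j → not (adj G i j) ∨ not ⌊ lookup c i Fin.≟ lookup c j ⌋) (allFin (V G))) (allFin (V G))

  usesAll : Bool
  usesAll = all (λ a → any (λ i → ⌊ lookup c i Fin.≟ a ⌋) (allFin (V G))) (allFin k)

rgs : ℕ → List ℕ → Bool
rgs m [] = true
rgs m (x ∷ xs) = (x ≤ᵇ m) ∧ rgs (if x ≡ᵇ m then suc m else m) xs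

isCanonical : ∀ {k v} → Vec (Fin k) v → Bool
isCanonical c = rgs 0 (map toℕ (toList c))

S : Graph → ℕ → ℕ
S G k = length (filterᵇ (λ c → isProper G c ∧ usesAll G c ∧ isCanonical c) (allColorings k (V G)))

-- Σ_{i=a}^{b} f i  (empty if b < a)
ΣFromTo : ℕ → ℕ → (ℕ → ℕ) → ℕ
ΣFromTo a b f = sum (map (λ i → f (a + i)) (upTo (suc b ∸ a)))

-- B(G) = Σ_{k≥1} S(G,k); S(G,k) = 0 for k > |V(G)|, so the sum stops at |V(G)|
B : Graph → ℕ
B G = ΣFromTo 1 (V G) (S G)

T : Graph → ℕ
T G = ΣFromTo 1 (V G) (λ k → k * S G k)

-- ratio t b = t / b as a rational (convention: 0 when b = 0; never used here)
ratio : ℕ → ℕ → ℚ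
ratio t zero = 0ℚ
ratio t (suc b) = (+ t) / suc b

A : Graph → ℚ
A G = ratio (T G) (B G)

stirling2 : ℕ → ℕ → ℕ
stirling2 zero zero = 1
stirling2 zero (suc b) = 0
stirling2 (suc a) zero = 0
stirling2 (suc a) (suc b) = suc b * stirling2 a (suc b) + stirling2 a b

term : ℕ → ℕ → ℕ → ℕ → ℕ
term n p k j = ((k ∸ j) C (n ∸ j)) * (n C j) * ((n ∸ j) !) * stirling2 p (k ∸ j)

-- A colouring of K_n ∪ pK_1 is read through its canonical colour vector, the restricted growth
-- string in which colours appear in order of first use. Properness forces the clique vertices to
-- open the colours 0, …, n − 1, so S(K_n ∪ pK_1, k) counts restricted growth continuations of
-- length p that start with n colours used and end with k. These numbers E(k, m, v) satisfy
-- E(k, m, v + 1) = m E(k, m, v) + E(k, m + 1, v), and hence also the Stirling-type recurrence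
-- E(k + 1, m, v + 1) = (k + 1) E(k + 1, m, v) + E(k, m, v). Reindexed by i = n − j, the inner sum
-- of the formula is Σᵢ C(d + i, i) n(n − 1)⋯(n − i + 1) {p brace d + i}; Stirling's recurrence and
-- Pascal's rule show that it obeys the same recurrence in (p, d), so it equals S(K_n ∪ pK_1, n + d).
-- As S vanishes below n (and n ≥ 1 removes k = 0), numerator and denominator of A agree termwise.

module Submission where

open import Data.Bool using (Bool; true; false; T; _∧_; _∨_; not; if_then_else_)
open import Data.Bool.ListAction using (all; any)
open import Data.Bool.Properties using (T-∧; T-≡; T?)
open import Data.Empty using (⊥-elim)
open import Data.Fin as Fin using (Fin; toℕ)
open import Data.Fin.Permutation using (reverse)
open import Data.Fin.Properties as Finₚ
  using (toℕ<n; toℕ-inject₁; toℕ-fromℕ; toℕ-fromℕ<; toℕ-injective; opposite-prop)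
open import Data.List using (List; []; _∷_; _++_; map; length; filterᵇ; concatMap; tabulate; allFin; applyUpTo)
open import Data.List.Properties using (filter-++; length-++; filter-≐; map-upTo)
import Data.List.Relation.Unary.All.Properties as All
import Data.List.Relation.Unary.Any.Properties as Any
open import Data.Nat
open import Data.Nat.Combinatorics using (_C_; nCn≡1; nCk≡nC[n∸k]; nCk+nC[k+1]≡[n+1]C[k+1])
open import Data.Nat.Combinatorics.Base using (_P′_)
import Data.Nat.ListAction as List
open import Data.Nat.Properties
open import Algebra.Properties.CommutativeSemigroup *-commutativeSemigroup using (x∙yz≈y∙xz)
open import Algebra.Properties.Semiring.Sum +-*-semiring
open import Data.Nat.Tactic.RingSolver using (solve-∀)
open import Data.Product using (_×_; _,_; proj₁; proj₂; ∃; uncurry; map₂)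
open import Data.Sum using (_⊎_; inj₁; inj₂; [_,_]′)
open import Data.Unit using (tt)
open import Data.Vec using (Vec; []; _∷_; lookup; toList)
open import Function using (id; _∘_; _⇔_; mk⇔; Equivalence)
open Equivalence using (to; from)
open import Relation.Binary.PropositionalEquality
open import Relation.Nullary using (Dec; yes; no; ¬_)
open import Relation.Nullary.Decidable using (⌊_⌋; toWitness; fromWitness; dec-true; dec-false)

open import Defs
  using ( Graph; V; adj; isProper; usesAll; isCanonical; rgs; cliqueAdj; KnUpK1; allColorings
        ; S; A; ratio; ΣFromTo; stirling2; term )

∑-cong : ∀ N {f g : ℕ → ℕ} → (∀ i → i < N → f i ≡ g i) →
         ∑[ i < N ] f (toℕ i) ≡ ∑[ i < N ] g (toℕ i)
∑-cong N f≡g = sum-cong-≗ (λ i → f≡g (toℕ i) (toℕ<n i))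

∑-zero : ∀ N {f : ℕ → ℕ} → (∀ i → i < N → f i ≡ 0) → ∑[ i < N ] f (toℕ i) ≡ 0
∑-zero N f≡0 = trans (∑-cong N f≡0) (sum-replicate-zero N)

∑-last : ∀ N (f : ℕ → ℕ) → ∑[ i < suc N ] f (toℕ i) ≡ ∑[ i < N ] f (toℕ i) + f N
∑-last N f = trans (sum-init-last {N} (λ i → f (toℕ i)))
  (cong₂ _+_ (sum-cong-≗ {N} (λ i → cong f (toℕ-inject₁ i))) (cong f (toℕ-fromℕ N)))

∑-last-zero : ∀ N (f : ℕ → ℕ) → f N ≡ 0 → ∑[ i < suc N ] f (toℕ i) ≡ ∑[ i < N ] f (toℕ i)
∑-last-zero N f fN≡0 = trans (∑-last N f) (trans (cong (∑[ i < N ] f (toℕ i) +_) fN≡0) (+-identityʳ _))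

∑-split : ∀ M N (f : ℕ → ℕ) →
          ∑[ i < M + N ] f (toℕ i) ≡ ∑[ i < M ] f (toℕ i) + ∑[ i < N ] f (M + toℕ i)
∑-split zero    N f = refl
∑-split (suc M) N f = trans (cong (f 0 +_) (∑-split M N (f ∘ suc))) (sym (+-assoc (f 0) _ _))

∑-reverse : ∀ N (f : ℕ → ℕ) → ∑[ i < N ] f (toℕ i) ≡ ∑[ i < N ] f (N ∸ suc (toℕ i))
∑-reverse N f = trans (sum-permute {N} (λ i → f (toℕ i)) reverse)
                      (sum-cong-≗ {N} (λ i → cong f (opposite-prop i)))

sum-applyUpTo : ∀ N (f : ℕ → ℕ) → List.sum (applyUpTo f N) ≡ ∑[ i < N ] f (toℕ i)
sum-applyUpTo zero    f = refl
sum-applyUpTo (suc N) f = cong (f 0 +_) (sum-applyUpTo N (f ∘ suc))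

ΣFromTo≡∑ : ∀ a b f → ΣFromTo a b f ≡ ∑[ i < suc b ∸ a ] f (a + toℕ i)
ΣFromTo≡∑ a b f = trans (cong List.sum (map-upTo (λ i → f (a + i)) (suc b ∸ a)))
                        (sum-applyUpTo (suc b ∸ a) (λ i → f (a + i)))

ΣFromTo-offset : ∀ n p f → ΣFromTo n (n + p) f ≡ ∑[ d < suc p ] f (n + toℕ d)
ΣFromTo-offset n p f = trans (ΣFromTo≡∑ n (n + p) f)
  (cong (λ N → ∑[ d < N ] f (n + toℕ d)) (trans (cong (_∸ n) (sym (+-suc n p))) (m+n∸m≡n n (suc p))))

ΣFromTo-1-offset : ∀ n p f → 1 ≤ n → (∀ k → k < n → f k ≡ 0) →
                   ΣFromTo 1 (n + p) f ≡ ∑[ d < suc p ] f (n + toℕ d)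
ΣFromTo-1-offset n p f 1≤n f≡0 = begin
  ΣFromTo 1 (n + p) f                                     ≡⟨ ΣFromTo≡∑ 1 (n + p) f ⟩
  ∑[ i < n + p ] f (suc (toℕ i))                          ≡⟨ cong (_+ ∑[ i < n + p ] f (suc (toℕ i))) (f≡0 0 1≤n) ⟨
  ∑[ i < suc (n + p) ] f (toℕ i)                          ≡⟨ cong (λ N → ∑[ i < N ] f (toℕ i)) (+-suc n p) ⟨
  ∑[ i < n + suc p ] f (toℕ i)                            ≡⟨ ∑-split n (suc p) f ⟩
  ∑[ i < n ] f (toℕ i) + ∑[ d < suc p ] f (n + toℕ d)     ≡⟨ cong (_+ ∑[ d < suc p ] f (n + toℕ d)) (∑-zero n f≡0) ⟩
  ∑[ d < suc p ] f (n + toℕ d)                            ∎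
  where open ≡-Reasoning

-- `does (m ≟ n)` computes to `m ≡ᵇ n`, and likewise for `_≤?_` and `_<?_`.
≡ᵇ-true : ∀ {m n} → m ≡ n → (m ≡ᵇ n) ≡ true
≡ᵇ-true = dec-true (_ ≟ _)

≡ᵇ-false : ∀ {m n} → m ≢ n → (m ≡ᵇ n) ≡ false
≡ᵇ-false = dec-false (_ ≟ _)

≤ᵇ-true : ∀ {m n} → m ≤ n → (m ≤ᵇ n) ≡ true
≤ᵇ-true = dec-true (_ ≤? _)

≤ᵇ-false : ∀ {m n} → ¬ m ≤ n → (m ≤ᵇ n) ≡ false
≤ᵇ-false = dec-false (_ ≤? _)

<ᵇ-true : ∀ {m n} → m < n → (m <ᵇ n) ≡ true
<ᵇ-true = dec-true (_ <? _)

<ᵇ-false : ∀ {m n} → ¬ m < n → (m <ᵇ n) ≡ false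
<ᵇ-false = dec-false (_ <? _)

k>n⇒nP′k≡0 : ∀ {n k} → n < k → n P′ k ≡ 0
k>n⇒nP′k≡0 {n} {suc k} (s≤s n≤k) with m≤n⇒m<n∨m≡n n≤k
... | inj₁ n<k  = trans (cong ((n ∸ k) *_) (k>n⇒nP′k≡0 n<k)) (*-zeroʳ (n ∸ k))
... | inj₂ refl = cong (_* (n P′ n)) (n∸n≡0 n)

[n+1]P′[k+1]≡[n+1]*nP′k : ∀ n k → suc n P′ suc k ≡ suc n * (n P′ k)
[n+1]P′[k+1]≡[n+1]*nP′k n zero    = refl
[n+1]P′[k+1]≡[n+1]*nP′k n (suc k) =
  trans (cong ((n ∸ k) *_) ([n+1]P′[k+1]≡[n+1]*nP′k n k)) (x∙yz≈y∙xz (n ∸ k) (suc n) (n P′ k))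

nCk*k!≡nP′k : ∀ n k → (n C k) * k ! ≡ n P′ k
nCk*k!≡nP′k n       zero    = refl
nCk*k!≡nP′k zero    (suc k) = sym (k>n⇒nP′k≡0 {0} {suc k} z<s)
nCk*k!≡nP′k (suc n) (suc k) = begin
  (suc n C suc k) * (suc k * k !)                  ≡⟨ cong (_* (suc k * k !)) (nCk+nC[k+1]≡[n+1]C[k+1] n k) ⟨
  ((n C k) + (n C suc k)) * (suc k * k !)          ≡⟨ distrib (n C k) (n C suc k) (suc k) (k !) ⟩
  suc k * ((n C k) * k !) + (n C suc k) * suc k !  ≡⟨ cong₂ (λ a b → suc k * a + b) (nCk*k!≡nP′k n k) (nCk*k!≡nP′k n (suc k)) ⟩
  suc k * (n P′ k) + (n ∸ k) * (n P′ k)            ≡⟨ *-distribʳ-+ (n P′ k) (suc k) (n ∸ k) ⟨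
  (suc k + (n ∸ k)) * (n P′ k)                     ≡⟨ factor ⟩
  suc n * (n P′ k)                                 ≡⟨ [n+1]P′[k+1]≡[n+1]*nP′k n k ⟨
  suc n P′ suc k                                   ∎
  where
  open ≡-Reasoning
  distrib : ∀ a b c f → (a + b) * (c * f) ≡ c * (a * f) + b * (c * f)
  distrib = solve-∀
  factor : (suc k + (n ∸ k)) * (n P′ k) ≡ suc n * (n P′ k)
  factor with k ≤? n
  ... | yes k≤n = cong (λ m → suc m * (n P′ k)) (m+[n∸m]≡n k≤n)
  ... | no  k≰n rewrite k>n⇒nP′k≡0 (≰⇒> k≰n) = trans (*-zeroʳ (suc k + (n ∸ k))) (sym (*-zeroʳ (suc n)))

pascal-diagonal : ∀ d i → (suc d + suc i) C suc i ≡ (d + suc i) C suc i + (suc d + i) C i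
pascal-diagonal d i = begin
  suc (d + suc i) C suc i                      ≡⟨ nCk+nC[k+1]≡[n+1]C[k+1] (d + suc i) i ⟨
  (d + suc i) C i + (d + suc i) C suc i        ≡⟨ cong (λ m → m C i + (d + suc i) C suc i) (+-suc d i) ⟩
  (suc d + i) C i + (d + suc i) C suc i        ≡⟨ +-comm ((suc d + i) C i) _ ⟩
  (d + suc i) C suc i + (suc d + i) C i        ∎
  where open ≡-Reasoning

stirling2↓ : ℕ → ℕ → ℕ
stirling2↓ p zero    = 0
stirling2↓ p (suc m) = stirling2 p m

stirling2-suc : ∀ p m → stirling2 (suc p) m ≡ m * stirling2 p m + stirling2↓ p m
stirling2-suc p zero    = refl
stirling2-suc p (suc m) = refl

merging : ℕ → ℕ → ℕ → ℕ → ℕ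
merging n p d i = ((d + i) C i) * (n P′ i) * stirling2 p (d + i)

-- Partitions of K_n ∪ pK_1 into n + d independent sets: split the p isolated vertices into d + i
-- blocks and let i of them join distinct clique vertices, in C(d + i, i) · n(n − 1)⋯(n − i + 1) ways.
mergings : ℕ → ℕ → ℕ → ℕ
mergings n p d = ∑[ i < suc n ] merging n p d (toℕ i)

-- Both sides of the recurrence in p split off `weighted`, by Stirling's recurrence on the left and
-- n + d = (d + i) + (n − i) on the right; the remainders differ by an index shift (Pascal's rule).
module _ (n p : ℕ) where
  private
    weightedTerm shiftedStirlingTerm shiftedFallingTerm : ℕ → ℕ → ℕ
    weightedTerm        d i = (d + i) * merging n p d i
    shiftedStirlingTerm d i = ((d + i) C i) * (n P′ i) * stirling2↓ p (d + i)
    shiftedFallingTerm  d i = ((d + i) C i) * (n P′ suc i) * stirling2 p (d + i)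

    weighted shiftedStirling shiftedFalling : ℕ → ℕ
    weighted        d = ∑[ i < suc n ] weightedTerm d (toℕ i)
    shiftedStirling d = ∑[ i < suc n ] shiftedStirlingTerm d (toℕ i)
    shiftedFalling  d = ∑[ i < suc n ] shiftedFallingTerm d (toℕ i)

    mergings-suc-split : ∀ d → mergings n (suc p) d ≡ weighted d + shiftedStirling d
    mergings-suc-split d = trans (∑-cong (suc n) split)
                                 (∑-distrib-+ {suc n} (weightedTerm d ∘ toℕ) (shiftedStirlingTerm d ∘ toℕ))
      where
      split : ∀ i → i < suc n → merging n (suc p) d i ≡ weightedTerm d i + shiftedStirlingTerm d i
      split i _ rewrite stirling2-suc p (d + i) =
        distrib (((d + i) C i) * (n P′ i)) (d + i) (stirling2 p (d + i)) (stirling2↓ p (d + i))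
        where distrib : ∀ a b c e → a * (b * c + e) ≡ b * (a * c) + a * e
              distrib = solve-∀

    *-mergings-split : ∀ d → (n + d) * mergings n p d ≡ weighted d + shiftedFalling d
    *-mergings-split d = trans (*-distribˡ-sum {suc n} (n + d) (merging n p d ∘ toℕ))
                        (trans (∑-cong (suc n) split)
                               (∑-distrib-+ {suc n} (weightedTerm d ∘ toℕ) (shiftedFallingTerm d ∘ toℕ)))
      where
      split : ∀ i → i < suc n → (n + d) * merging n p d i ≡ weightedTerm d i + shiftedFallingTerm d i
      split i (s≤s i≤n) = trans (cong (λ m → (m + d) * merging n p d i) (sym (m+[n∸m]≡n i≤n)))
                                (distrib i (n ∸ i) d ((d + i) C i) (n P′ i) (stirling2 p (d + i)))
        where distrib : ∀ i m d b f s → (i + m + d) * (b * f * s) ≡ (d + i) * (b * f * s) + b * (m * f) * s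
              distrib = solve-∀

    shifted-zero : shiftedStirling 0 ≡ shiftedFalling 0
    shifted-zero = begin
      ∑[ i < n ] shiftedStirlingTerm 0 (suc (toℕ i))
        ≡⟨ ∑-cong n (λ i _ → cong (λ c → c * (n P′ suc i) * stirling2 p i)
                                 (trans (nCn≡1 (suc i)) (sym (nCn≡1 i)))) ⟩
      ∑[ i < n ] shiftedFallingTerm 0 (toℕ i)
        ≡⟨ ∑-last-zero n (shiftedFallingTerm 0) last≡0 ⟨
      shiftedFalling 0 ∎
      where
      open ≡-Reasoning
      last≡0 : shiftedFallingTerm 0 n ≡ 0
      last≡0 rewrite k>n⇒nP′k≡0 (n<1+n n) | *-zeroʳ (n C n) = refl

    shifted-suc : ∀ d → shiftedStirling (suc d) ≡ shiftedFalling (suc d) + mergings n p d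
    shifted-suc d = begin
      shiftedStirling (suc d)                              ≡⟨ ∑-cong (suc n) split ⟩
      ∑[ i < suc n ] (merging n p d (toℕ i) + new (toℕ i)) ≡⟨ ∑-distrib-+ {suc n} (merging n p d ∘ toℕ) (new ∘ toℕ) ⟩
      mergings n p d + ∑[ i < n ] new (suc (toℕ i))        ≡⟨ cong (mergings n p d +_) (∑-last-zero n (new ∘ suc) new-last≡0) ⟨
      mergings n p d + ∑[ i < suc n ] new (suc (toℕ i))    ≡⟨ cong (mergings n p d +_) (∑-cong (suc n) (λ i _ → new-suc i)) ⟩
      mergings n p d + shiftedFalling (suc d)              ≡⟨ +-comm (mergings n p d) _ ⟩
      shiftedFalling (suc d) + mergings n p d              ∎
      where
      open ≡-Reasoning
      new : ℕ → ℕ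
      new zero    = 0
      new (suc i) = ((suc d + i) C i) * (n P′ suc i) * stirling2 p (d + suc i)
      new-suc : ∀ i → new (suc i) ≡ shiftedFallingTerm (suc d) i
      new-suc i = cong (λ m → ((suc d + i) C i) * (n P′ suc i) * stirling2 p m) (+-suc d i)
      new-last≡0 : new (suc n) ≡ 0
      new-last≡0 rewrite k>n⇒nP′k≡0 (n<1+n n) | *-zeroʳ ((suc d + n) C n) = refl
      split : ∀ i → i < suc n → shiftedStirlingTerm (suc d) i ≡ merging n p d i + new i
      split zero    _ = sym (+-identityʳ _)
      split (suc i) _ = trans (cong (λ c → c * (n P′ suc i) * stirling2 p (d + suc i)) (pascal-diagonal d i))
                              (distrib ((d + suc i) C suc i) ((suc d + i) C i) (n P′ suc i) (stirling2 p (d + suc i)))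
        where distrib : ∀ a b f s → (a + b) * f * s ≡ a * f * s + b * f * s
              distrib = solve-∀

  mergings-suc-zero : mergings n (suc p) 0 ≡ n * mergings n p 0
  mergings-suc-zero = begin
    mergings n (suc p) 0              ≡⟨ mergings-suc-split 0 ⟩
    weighted 0 + shiftedStirling 0    ≡⟨ cong (weighted 0 +_) shifted-zero ⟩
    weighted 0 + shiftedFalling 0     ≡⟨ *-mergings-split 0 ⟨
    (n + 0) * mergings n p 0          ≡⟨ cong (_* mergings n p 0) (+-identityʳ n) ⟩
    n * mergings n p 0                ∎
    where open ≡-Reasoning

  mergings-suc-suc : ∀ d → mergings n (suc p) (suc d) ≡ (n + suc d) * mergings n p (suc d) + mergings n p d
  mergings-suc-suc d = begin
    mergings n (suc p) (suc d)                                   ≡⟨ mergings-suc-split (suc d) ⟩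
    weighted (suc d) + shiftedStirling (suc d)                   ≡⟨ cong (weighted (suc d) +_) (shifted-suc d) ⟩
    weighted (suc d) + (shiftedFalling (suc d) + mergings n p d) ≡⟨ +-assoc (weighted (suc d)) _ _ ⟨
    weighted (suc d) + shiftedFalling (suc d) + mergings n p d   ≡⟨ cong (_+ mergings n p d) (*-mergings-split (suc d)) ⟨
    (n + suc d) * mergings n p (suc d) + mergings n p d          ∎
    where open ≡-Reasoning

mergings-zero-zero : ∀ n → mergings n 0 0 ≡ 1
mergings-zero-zero n = cong suc (∑-zero n (λ i _ → *-zeroʳ (((suc i) C suc i) * (n P′ suc i))))

mergings-zero-suc : ∀ n d → mergings n 0 (suc d) ≡ 0
mergings-zero-suc n d = ∑-zero (suc n) (λ i _ → *-zeroʳ (((suc d + i) C i) * (n P′ i)))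

term-reflect : ∀ n p d {i} → i ≤ n → term n p (n + d) (n ∸ i) ≡ merging n p d i
term-reflect n p d {i} i≤n = begin
  ((n + d ∸ (n ∸ i)) C (n ∸ (n ∸ i))) * (n C (n ∸ i)) * ((n ∸ (n ∸ i)) !) * stirling2 p (n + d ∸ (n ∸ i))
    ≡⟨ cong₂ (λ a b → (a C b) * (n C (n ∸ i)) * (b !) * stirling2 p a) n+d∸[n∸i]≡d+i (m∸[m∸n]≡n i≤n) ⟩
  ((d + i) C i) * (n C (n ∸ i)) * (i !) * stirling2 p (d + i)
    ≡⟨ cong (λ c → ((d + i) C i) * c * (i !) * stirling2 p (d + i)) (nCk≡nC[n∸k] i≤n) ⟨
  ((d + i) C i) * (n C i) * (i !) * stirling2 p (d + i)
    ≡⟨ cong (_* stirling2 p (d + i)) (trans (*-assoc ((d + i) C i) (n C i) (i !))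
                                            (cong (((d + i) C i) *_) (nCk*k!≡nP′k n i))) ⟩
  merging n p d i ∎
  where
  open ≡-Reasoning
  n+d∸[n∸i]≡d+i : n + d ∸ (n ∸ i) ≡ d + i
  n+d∸[n∸i]≡d+i = trans (+-∸-comm d (m∸n≤m n i)) (trans (cong (_+ d) (m∸[m∸n]≡n i≤n)) (+-comm i d))

∑term≡mergings : ∀ n p d → ΣFromTo 0 n (term n p (n + d)) ≡ mergings n p d
∑term≡mergings n p d = begin
  ΣFromTo 0 n (term n p (n + d))                         ≡⟨ ΣFromTo≡∑ 0 n (term n p (n + d)) ⟩
  ∑[ j < suc n ] term n p (n + d) (toℕ j)                ≡⟨ ∑-reverse (suc n) (term n p (n + d)) ⟩
  ∑[ i < suc n ] term n p (n + d) (n ∸ toℕ i)            ≡⟨ ∑-cong (suc n) (λ i i<1+n → term-reflect n p d (s≤s⁻¹ i<1+n)) ⟩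
  mergings n p d                                         ∎
  where open ≡-Reasoning

-- Continuations of length v of a restricted growth string that has used m colours, ending with
-- exactly k colours used: each letter reuses one of the m colours or opens colour m.
extensions : ℕ → ℕ → ℕ → ℕ
extensions k m zero    = if m ≡ᵇ k then 1 else 0
extensions k m (suc v) = m * extensions k m v + extensions k (suc m) v

extensions-vanish : ∀ {k m} v → k < m → extensions k m v ≡ 0
extensions-vanish {k} {m} zero    k<m rewrite ≡ᵇ-false (>⇒≢ k<m) = refl
extensions-vanish {k} {m} (suc v) k<m
  rewrite extensions-vanish v k<m | extensions-vanish v (m<n⇒m<1+n k<m) | *-zeroʳ m = refl

extensions-suc : ∀ k m v → extensions (suc k) m (suc v) ≡ suc k * extensions (suc k) m v + extensions k m v
extensions-suc k m zero with m ≟ suc k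
... | yes refl = refl
... | no  m≢1+k rewrite ≡ᵇ-false m≢1+k =
  cong (_+ (if m ≡ᵇ k then 1 else 0)) (trans (*-zeroʳ m) (sym (*-zeroʳ (suc k))))
extensions-suc k m (suc v) = trans (cong₂ (λ a b → m * a + b) (extensions-suc k m v) (extensions-suc k (suc m) v))
  (distrib m (suc k) (extensions (suc k) m v) (extensions k m v) (extensions (suc k) (suc m) v) (extensions k (suc m) v))
  where distrib : ∀ m K a b c e → m * (K * a + b) + (K * c + e) ≡ K * (m * a + c) + (m * b + e)
        distrib = solve-∀

extensions≡mergings : ∀ n p d → extensions (n + d) n p ≡ mergings n p d
extensions≡mergings n zero zero rewrite +-identityʳ n | ≡ᵇ-true (refl {x = n}) = sym (mergings-zero-zero n)
extensions≡mergings n zero (suc d) rewrite ≡ᵇ-false (<⇒≢ (m<m+n n (z<s {d}))) = sym (mergings-zero-suc n d)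
extensions≡mergings n (suc p) zero = begin
  extensions (n + 0) n (suc p)                          ≡⟨ cong (λ k → extensions k n (suc p)) (+-identityʳ n) ⟩
  n * extensions n n p + extensions n (suc n) p         ≡⟨ cong (n * extensions n n p +_) (extensions-vanish p (n<1+n n)) ⟩
  n * extensions n n p + 0                              ≡⟨ +-identityʳ _ ⟩
  n * extensions n n p                                  ≡⟨ cong (λ k → n * extensions k n p) (+-identityʳ n) ⟨
  n * extensions (n + 0) n p                            ≡⟨ cong (n *_) (extensions≡mergings n p 0) ⟩
  n * mergings n p 0                                    ≡⟨ mergings-suc-zero n p ⟨
  mergings n (suc p) 0                                  ∎
  where open ≡-Reasoning
extensions≡mergings n (suc p) (suc d) = begin
  extensions (n + suc d) n (suc p)                      ≡⟨ cong (λ k → extensions k n (suc p)) (+-suc n d) ⟩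
  extensions (suc (n + d)) n (suc p)                    ≡⟨ extensions-suc (n + d) n p ⟩
  suc (n + d) * extensions (suc (n + d)) n p + extensions (n + d) n p
    ≡⟨ cong (λ k → k * extensions k n p + extensions (n + d) n p) (+-suc n d) ⟨
  (n + suc d) * extensions (n + suc d) n p + extensions (n + d) n p
    ≡⟨ cong₂ (λ a b → (n + suc d) * a + b) (extensions≡mergings n p (suc d)) (extensions≡mergings n p d) ⟩
  (n + suc d) * mergings n p (suc d) + mergings n p d   ≡⟨ mergings-suc-suc n p d ⟨
  mergings n (suc p) (suc d)                            ∎
  where open ≡-Reasoning

count : ∀ {a} {X : Set a} → (X → Bool) → List X → ℕ
count P xs = length (filterᵇ P xs)

module _ {a} {X : Set a} where

  count-++ : ∀ (P : X → Bool) xs ys → count P (xs ++ ys) ≡ count P xs + count P ys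
  count-++ P xs ys = trans (cong length (filter-++ (T? ∘ P) xs ys)) (length-++ (filterᵇ P xs))

  count-map : ∀ {b} {Y : Set b} (P : X → Bool) (f : Y → X) xs → count P (map f xs) ≡ count (P ∘ f) xs
  count-map P f []       = refl
  count-map P f (x ∷ xs) with P (f x)
  ... | true  = cong suc (count-map P f xs)
  ... | false = count-map P f xs

  count-≐ : ∀ {P Q : X → Bool} → (∀ x → T (P x) ⇔ T (Q x)) → ∀ xs → count P xs ≡ count Q xs
  count-≐ {P} {Q} P⇔Q xs = cong length (filter-≐ (T? ∘ P) (T? ∘ Q)
    ((λ {x} → to (P⇔Q x)) , (λ {x} → from (P⇔Q x))) xs)

  count-guard : ∀ b (P : X → Bool) xs → count (λ x → b ∧ P x) xs ≡ (if b then count P xs else 0)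
  count-guard true  P xs       = refl
  count-guard false P []       = refl
  count-guard false P (x ∷ xs) = count-guard false P xs

count-allColorings : ∀ k v (P : Vec (Fin k) (suc v) → Bool) →
  count P (allColorings k (suc v)) ≡ ∑[ x < k ] count (P ∘ (x ∷_)) (allColorings k v)
count-allColorings k v P = go id
  where
  go : ∀ {j} (f : Fin j → Fin k) →
    count P (concatMap (λ x → map (x ∷_) (allColorings k v)) (tabulate f))
      ≡ ∑[ x < j ] count (P ∘ (f x ∷_)) (allColorings k v)
  go {zero}  f = refl
  go {suc j} f = trans (count-++ P (map (f Fin.zero ∷_) (allColorings k v)) _)
                       (cong₂ _+_ (count-map P (f Fin.zero ∷_) (allColorings k v)) (go (f ∘ Fin.suc)))

∧-elim : ∀ {a b} → T (a ∧ b) → T a × T b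
∧-elim {a} = to (T-∧ {a})

∧-intro : ∀ {a b} → T a → T b → T (a ∧ b)
∧-intro {a} ta tb = from (T-∧ {a}) (ta , tb)

T-not : ∀ {b} → T (not b) ⇔ (¬ T b)
T-not {true}  = mk⇔ (λ ()) (λ f → f tt)
T-not {false} = mk⇔ (λ _ ()) (λ _ → tt)

T-all-allFin : ∀ {n} (P : Fin n → Bool) → T (all P (allFin n)) ⇔ (∀ i → T (P i))
T-all-allFin P = mk⇔ (All.tabulate⁻ ∘ All.all⁺ P _) (All.all⁻ P ∘ All.tabulate⁺)

T-any-allFin : ∀ {n} (P : Fin n → Bool) → T (any P (allFin n)) ⇔ ∃ λ i → T (P i)
T-any-allFin P = mk⇔ (Any.tabulate⁻ ∘ Any.any⁻ P _) (Any.any⁺ P ∘ uncurry Any.tabulate⁺)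

T-not-∨-not : ∀ a {ℓ} {Q : Set ℓ} (Q? : Dec Q) → T (not a ∨ not ⌊ Q? ⌋) ⇔ (T a → ¬ Q)
T-not-∨-not false Q?      = mk⇔ (λ _ ()) (λ _ → tt)
T-not-∨-not true  (yes q) = mk⇔ (λ ()) (λ f → f tt q)
T-not-∨-not true  (no ¬q) = mk⇔ (λ _ _ → ¬q) (λ _ → tt)

module _ (G : Graph) {k : ℕ} (c : Vec (Fin k) (V G)) where

  isProper⇔ : T (isProper G c) ⇔ (∀ i j → T (adj G i j) → lookup c i ≢ lookup c j)
  isProper⇔ = mk⇔
    (λ h i j → to (entry i j) (to (T-all-allFin _) (to (T-all-allFin _) h i) j))
    (λ h → from (T-all-allFin _) (λ i → from (T-all-allFin _) (λ j → from (entry i j) (h i j))))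
    where entry = λ i j → T-not-∨-not (adj G i j) (lookup c i Fin.≟ lookup c j)

  usesAll⇔ : T (usesAll G c) ⇔ (∀ a → ∃ λ i → lookup c i ≡ a)
  usesAll⇔ = mk⇔
    (λ h a → map₂ toWitness (to (T-any-allFin _) (to (T-all-allFin _) h a)))
    (λ h → from (T-all-allFin _) (λ a → from (T-any-allFin _) (map₂ fromWitness (h a))))

cliqueAdj⇔ : ∀ n p (i j : Fin (n + p)) → T (cliqueAdj n p i j) ⇔ (toℕ i < n × toℕ j < n × i ≢ j)
cliqueAdj⇔ n p i j = mk⇔
  (λ h → let both , i≢j = ∧-elim h ; i<n , j<n = ∧-elim both
         in <ᵇ⇒< _ _ i<n , <ᵇ⇒< _ _ j<n , to T-not i≢j ∘ ≡⇒≡ᵇ _ _ ∘ cong toℕ)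
  (λ (i<n , j<n , i≢j) → ∧-intro (∧-intro (<⇒<ᵇ i<n) (<⇒<ᵇ j<n)) (from T-not (i≢j ∘ toℕ-injective ∘ ≡ᵇ⇒≡ _ _)))

Distinct : ∀ {k v} → ℕ → Vec (Fin k) v → Set
Distinct {v = v} r c = ∀ (i j : Fin v) → toℕ i < r → toℕ j < r → i ≢ j → lookup c i ≢ lookup c j

isProper-clique⇔ : ∀ n p {k} (c : Vec (Fin k) (n + p)) → T (isProper (KnUpK1 n p) c) ⇔ Distinct n c
isProper-clique⇔ n p c = mk⇔
  (λ h i j i<n j<n i≢j → to (isProper⇔ (KnUpK1 n p) c) h i j
                           (from (cliqueAdj⇔ n p i j) (i<n , j<n , i≢j)))
  (λ h → from (isProper⇔ (KnUpK1 n p) c) λ i j i~j →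
           let i<n , j<n , i≢j = to (cliqueAdj⇔ n p i j) i~j in h i j i<n j<n i≢j)

grow : ℕ → ℕ → ℕ
grow m x = if x ≡ᵇ m then suc m else m

grow-≡ : ∀ {m x} → x ≡ m → grow m x ≡ suc m
grow-≡ x≡m rewrite ≡ᵇ-true x≡m = refl

m≤grow : ∀ m x → m ≤ grow m x
m≤grow m x with x ≡ᵇ m
... | true  = n≤1+n m
... | false = ≤-refl

<grow⇒ : ∀ {a} m x → a < grow m x → a < m ⊎ a ≡ x
<grow⇒ {a} m x a<g with x ≡ᵇ m in eq
... | false = inj₁ a<g
... | true  with m≤n⇒m<n∨m≡n (s≤s⁻¹ a<g)
...   | inj₁ a<m = inj₁ a<m
...   | inj₂ a≡m = inj₂ (trans a≡m (sym (≡ᵇ⇒≡ x m (from T-≡ eq))))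

≤⇒<grow : ∀ {m x} → x ≤ m → x < grow m x
≤⇒<grow {m} {x} x≤m with x ≡ᵇ m in eq
... | true  = s≤s x≤m
... | false = ≤∧≢⇒< x≤m (λ x≡m → subst T eq (≡⇒≡ᵇ x m x≡m))

module _ {k : ℕ} where

  colours : ∀ {v} → Vec (Fin k) v → List ℕ
  colours c = map toℕ (toList c)

  FreshFrom : ∀ {v} → ℕ → ℕ → Vec (Fin k) v → Set
  FreshFrom r m c = Distinct r c × (∀ i → toℕ i < r → m ≤ toℕ (lookup c i))

  Covers : ∀ {v} → ℕ → Vec (Fin k) v → Set
  Covers {v} m c = ∀ (a : Fin k) → toℕ a < m ⊎ ∃ λ (i : Fin v) → lookup c i ≡ a

  -- c opens the colours m, …, m + r − 1 in turn, then continues as a restricted growth string;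
  -- at the end the counter must have reached k, i.e. every colour has been used.
  canonical : ∀ {v} → ℕ → ℕ → Vec (Fin k) v → Bool
  canonical r       m []      = k ≤ᵇ m
  canonical (suc r) m (x ∷ c) = (toℕ x ≡ᵇ m) ∧ canonical r (suc m) c
  canonical zero    m (x ∷ c) = (toℕ x ≤ᵇ m) ∧ canonical zero (grow m (toℕ x)) c

  nothing-fresh : ∀ {v} m (c : Vec (Fin k) v) → FreshFrom 0 m c
  nothing-fresh m c = (λ _ _ ()) , (λ _ ())

  fresh-cons : ∀ {v r m x} {c : Vec (Fin k) v} →
               toℕ x ≡ m → FreshFrom r (suc m) c → FreshFrom (suc r) m (x ∷ c)
  fresh-cons {r = r} {m} {x} {c} x≡m (distinct , above) = distinct′ , above′
    where
    fresh-above : ∀ i → toℕ i < r → x ≢ lookup c i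
    fresh-above i i<r x≡ci = <⇒≢ (above i i<r) (trans (sym x≡m) (cong toℕ x≡ci))
    distinct′ : Distinct (suc r) (x ∷ c)
    distinct′ Fin.zero    Fin.zero    _         _         x≢x = ⊥-elim (x≢x refl)
    distinct′ Fin.zero    (Fin.suc j) _         (s≤s j<r) _   = λ x≡cj → fresh-above j j<r x≡cj
    distinct′ (Fin.suc i) Fin.zero    (s≤s i<r) _         _   = λ ci≡x → fresh-above i i<r (sym ci≡x)
    distinct′ (Fin.suc i) (Fin.suc j) (s≤s i<r) (s≤s j<r) i≢j = distinct i j i<r j<r (i≢j ∘ cong Fin.suc)
    above′ : ∀ i → toℕ i < suc r → m ≤ toℕ (lookup (x ∷ c) i)
    above′ Fin.zero    _         = ≤-reflexive (sym x≡m)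
    above′ (Fin.suc i) (s≤s i<r) = <⇒≤ (above i i<r)

  fresh-uncons : ∀ {v r m x} {c : Vec (Fin k) v} →
                 toℕ x ≡ m → FreshFrom (suc r) m (x ∷ c) → FreshFrom r (suc m) c
  fresh-uncons x≡m (distinct , above) =
      (λ i j i<r j<r i≢j → distinct (Fin.suc i) (Fin.suc j) (s≤s i<r) (s≤s j<r) (i≢j ∘ Finₚ.suc-injective))
    , (λ i i<r → ≤∧≢⇒< (above (Fin.suc i) (s≤s i<r))
                       (λ m≡ci → distinct Fin.zero (Fin.suc i) z<s (s≤s i<r) (λ ()) (toℕ-injective (trans x≡m m≡ci))))

  covers-[]⇒≥ : ∀ {m} → Covers m [] → k ≤ m
  covers-[]⇒≥ cov = ≮⇒≥ λ m<k → [ <-irrefl (toℕ-fromℕ< m<k) , (λ ()) ∘ proj₁ ]′ (cov (Fin.fromℕ< m<k))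

  ≥⇒covers-[] : ∀ {m} → k ≤ m → Covers m []
  ≥⇒covers-[] k≤m a = inj₁ (<-≤-trans (toℕ<n a) k≤m)

  covers-cons : ∀ {v m x} {c : Vec (Fin k) v} → Covers (grow m (toℕ x)) c → Covers m (x ∷ c)
  covers-cons {m = m} {x} cov a with cov a
  ... | inj₂ (i , ci≡a) = inj₂ (Fin.suc i , ci≡a)
  ... | inj₁ a<g with <grow⇒ m (toℕ x) a<g
  ...   | inj₁ a<m = inj₁ a<m
  ...   | inj₂ a≡x = inj₂ (Fin.zero , toℕ-injective (sym a≡x))

  covers-uncons : ∀ {v m x} {c : Vec (Fin k) v} → toℕ x ≤ m → Covers m (x ∷ c) → Covers (grow m (toℕ x)) c
  covers-uncons {m = m} {x} x≤m cov a with cov a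
  ... | inj₁ a<m                  = inj₁ (<-≤-trans a<m (m≤grow m (toℕ x)))
  ... | inj₂ (Fin.zero , x≡a)     = inj₁ (subst (_< grow m (toℕ x)) (cong toℕ x≡a) (≤⇒<grow x≤m))
  ... | inj₂ (Fin.suc i , ci≡a)   = inj₂ (i , ci≡a)

  canonical-sound : ∀ {v} r m (c : Vec (Fin k) v) →
    T (canonical r m c) → FreshFrom r m c × Covers m c × T (rgs m (colours c))
  canonical-sound r m [] h = ((λ ()) , (λ ())) , ≥⇒covers-[] (≤ᵇ⇒≤ k m h) , tt
  canonical-sound (suc r) m (x ∷ c) h =
    let x≡m? , h′ = ∧-elim h ; x≡m = ≡ᵇ⇒≡ _ _ x≡m? ; grown = sym (grow-≡ x≡m)
        fresh , cov , rg = canonical-sound r (suc m) c h′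
    in  fresh-cons x≡m fresh
      , covers-cons (subst (λ m′ → Covers m′ c) grown cov)
      , ∧-intro (≤⇒≤ᵇ (≤-reflexive x≡m)) (subst (λ m′ → T (rgs m′ (colours c))) grown rg)
  canonical-sound zero m (x ∷ c) h =
    let x≤m , h′ = ∧-elim h ; _ , cov , rg = canonical-sound zero (grow m (toℕ x)) c h′
    in  nothing-fresh m (x ∷ c) , covers-cons cov , ∧-intro x≤m rg

  canonical-complete : ∀ {v} r m (c : Vec (Fin k) v) →
    FreshFrom r m c → Covers m c → T (rgs m (colours c)) → T (canonical r m c)
  canonical-complete r m [] _ cov _ = ≤⇒≤ᵇ (covers-[]⇒≥ cov)
  canonical-complete (suc r) m (x ∷ c) fresh cov rg =
    let x≤m? , rg′ = ∧-elim rg ; x≤m = ≤ᵇ⇒≤ _ _ x≤m?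
        x≡m = ≤-antisym x≤m (proj₂ fresh Fin.zero z<s) ; grown = grow-≡ x≡m
    in  ∧-intro (≡⇒≡ᵇ _ _ x≡m)
          (canonical-complete r (suc m) c (fresh-uncons x≡m fresh)
            (subst (λ m′ → Covers m′ c) grown (covers-uncons x≤m cov))
            (subst (λ m′ → T (rgs m′ (colours c))) grown rg′))
  canonical-complete zero m (x ∷ c) _ cov rg =
    let x≤m? , rg′ = ∧-elim rg
    in  ∧-intro x≤m? (canonical-complete zero _ c (nothing-fresh _ c) (covers-uncons (≤ᵇ⇒≤ _ _ x≤m?) cov) rg′)

canonical⇔ : ∀ n p {k} (c : Vec (Fin k) (n + p)) →
  let G = KnUpK1 n p in T (isProper G c ∧ usesAll G c ∧ isCanonical c) ⇔ T (canonical n 0 c)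
canonical⇔ n p c = mk⇔ proper⇒canonical canonical⇒proper
  where
  G = KnUpK1 n p
  proper⇒canonical : T (isProper G c ∧ usesAll G c ∧ isCanonical c) → T (canonical n 0 c)
  proper⇒canonical h =
    let proper , h′ = ∧-elim h ; onto , rg = ∧-elim h′
    in  canonical-complete n 0 c (to (isProper-clique⇔ n p c) proper , λ _ _ → z≤n)
                                 (inj₂ ∘ to (usesAll⇔ G c) onto) rg
  canonical⇒proper : T (canonical n 0 c) → T (isProper G c ∧ usesAll G c ∧ isCanonical c)
  canonical⇒proper h =
    let (distinct , _) , cov , rg = canonical-sound n 0 c h
    in  ∧-intro (from (isProper-clique⇔ n p c) distinct)
                (∧-intro (from (usesAll⇔ G c) ([ (λ ()) , id ]′ ∘ cov)) rg)

grow-suc : ∀ m x → grow (suc m) (suc x) ≡ suc (grow m x)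
grow-suc m x with x ≡ᵇ m
... | true  = refl
... | false = refl

<ᵇ-suc : ∀ x m → (x <ᵇ suc m) ≡ (x ≤ᵇ m)
<ᵇ-suc zero    m = refl
<ᵇ-suc (suc x) m = refl

∑-indicator : ∀ k m a → ∑[ x < k ] (if toℕ x ≡ᵇ m then a else 0) ≡ (if m <ᵇ k then a else 0)
∑-indicator zero    m       a = refl
∑-indicator (suc k) zero    a = trans (cong (a +_) (∑-zero k (λ _ _ → refl))) (+-identityʳ a)
∑-indicator (suc k) (suc m) a = ∑-indicator k m a

∑-grow : ∀ k m (f : ℕ → ℕ) → m ≤ k →
  ∑[ x < k ] (if toℕ x ≤ᵇ m then f (grow m (toℕ x)) else 0) ≡ m * f m + (if m <ᵇ k then f (suc m) else 0)
∑-grow zero    zero    f _         = refl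
∑-grow (suc k) zero    f _         = trans (cong (f 1 +_) (∑-zero k (λ _ _ → refl))) (+-identityʳ (f 1))
∑-grow (suc k) (suc m) f (s≤s m≤k) = begin
  f (suc m) + ∑[ x < k ] (if toℕ x <ᵇ suc m then f (grow (suc m) (suc (toℕ x))) else 0)
    ≡⟨ cong (f (suc m) +_) (∑-cong k (λ x _ → cong₂ (λ b y → if b then f y else 0) (<ᵇ-suc x m) (grow-suc m x))) ⟩
  f (suc m) + ∑[ x < k ] (if toℕ x ≤ᵇ m then f (suc (grow m (toℕ x))) else 0)
    ≡⟨ cong (f (suc m) +_) (∑-grow k m (f ∘ suc) m≤k) ⟩
  f (suc m) + (m * f (suc m) + (if m <ᵇ k then f (suc (suc m)) else 0))
    ≡⟨ +-assoc (f (suc m)) _ _ ⟨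
  suc m * f (suc m) + (if m <ᵇ k then f (suc (suc m)) else 0) ∎
  where open ≡-Reasoning

module _ (k : ℕ) where

  colourings : ℕ → ℕ → ℕ → ℕ
  colourings r m v = count (canonical {k} r m) (allColorings k v)

  colourings-fresh-suc : ∀ r m v → colourings (suc r) m (suc v) ≡ (if m <ᵇ k then colourings r (suc m) v else 0)
  colourings-fresh-suc r m v = begin
    colourings (suc r) m (suc v)
      ≡⟨ count-allColorings k v (canonical (suc r) m) ⟩
    ∑[ x < k ] count (λ c → (toℕ x ≡ᵇ m) ∧ canonical r (suc m) c) (allColorings k v)
      ≡⟨ sum-cong-≗ {k} (λ x → count-guard (toℕ x ≡ᵇ m) (canonical r (suc m)) (allColorings k v)) ⟩
    ∑[ x < k ] (if toℕ x ≡ᵇ m then colourings r (suc m) v else 0)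
      ≡⟨ ∑-indicator k m (colourings r (suc m) v) ⟩
    (if m <ᵇ k then colourings r (suc m) v else 0) ∎
    where open ≡-Reasoning

  colourings-rgs-suc : ∀ m v → m ≤ k →
    colourings 0 m (suc v) ≡ m * colourings 0 m v + (if m <ᵇ k then colourings 0 (suc m) v else 0)
  colourings-rgs-suc m v m≤k = begin
    colourings 0 m (suc v)
      ≡⟨ count-allColorings k v (canonical 0 m) ⟩
    ∑[ x < k ] count (λ c → (toℕ x ≤ᵇ m) ∧ canonical 0 (grow m (toℕ x)) c) (allColorings k v)
      ≡⟨ sum-cong-≗ {k} (λ x → count-guard (toℕ x ≤ᵇ m) (canonical 0 (grow m (toℕ x))) (allColorings k v)) ⟩
    ∑[ x < k ] (if toℕ x ≤ᵇ m then colourings 0 (grow m (toℕ x)) v else 0)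
      ≡⟨ ∑-grow k m (λ m′ → colourings 0 m′ v) m≤k ⟩
    m * colourings 0 m v + (if m <ᵇ k then colourings 0 (suc m) v else 0) ∎
    where open ≡-Reasoning

  colourings-empty : ∀ r m → m ≤ k → colourings r m 0 ≡ extensions k m 0
  colourings-empty r m m≤k with m ≟ k
  ... | yes refl rewrite ≤ᵇ-true (≤-refl {m}) | ≡ᵇ-true (refl {x = m}) = refl
  ... | no  m≢k  rewrite ≤ᵇ-false (<⇒≱ (≤∧≢⇒< m≤k m≢k)) | ≡ᵇ-false m≢k = refl

  colourings-rgs : ∀ m v → m ≤ k → colourings 0 m v ≡ extensions k m v
  colourings-rgs m zero    m≤k = colourings-empty 0 m m≤k
  colourings-rgs m (suc v) m≤k with m <? k
  ... | yes m<k rewrite colourings-rgs-suc m v m≤k | <ᵇ-true m<k =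
    cong₂ (λ a b → m * a + b) (colourings-rgs m v m≤k) (colourings-rgs (suc m) v m<k)
  ... | no  m≮k rewrite colourings-rgs-suc m v m≤k | <ᵇ-false m≮k | ≤-antisym m≤k (≮⇒≥ m≮k) =
    cong₂ (λ a b → k * a + b) (colourings-rgs k v ≤-refl) (sym (extensions-vanish v (n<1+n k)))

  colourings-fresh : ∀ r m v → m ≤ k → colourings r m (r + v) ≡ extensions k (m + r) v
  colourings-fresh zero    m v m≤k rewrite +-identityʳ m = colourings-rgs m v m≤k
  colourings-fresh (suc r) m v m≤k with m <? k
  ... | yes m<k rewrite colourings-fresh-suc r m (r + v) | <ᵇ-true m<k | +-suc m r = colourings-fresh r (suc m) v m<k
  ... | no  m≮k rewrite colourings-fresh-suc r m (r + v) | <ᵇ-false m≮k | ≤-antisym m≤k (≮⇒≥ m≮k) =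
    sym (extensions-vanish v (m<m+n k z<s))

S≡extensions : ∀ n p k → S (KnUpK1 n p) k ≡ extensions k n p
S≡extensions n p k = trans (count-≐ (canonical⇔ n p) (allColorings k (n + p))) (colourings-fresh k n 0 p z≤n)

S-KnUpK1 : ∀ n p d → S (KnUpK1 n p) (n + d) ≡ ΣFromTo 0 n (term n p (n + d))
S-KnUpK1 n p d = trans (S≡extensions n p (n + d)) (trans (extensions≡mergings n p d) (sym (∑term≡mergings n p d)))

S-KnUpK1-below : ∀ n p {k} → k < n → S (KnUpK1 n p) k ≡ 0
S-KnUpK1-below n p {k} k<n = trans (S≡extensions n p k) (extensions-vanish p k<n)

ΣFromTo-S-KnUpK1 : ∀ n p (F : ℕ → ℕ → ℕ) → (∀ k → F k 0 ≡ 0) → 1 ≤ n →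
  ΣFromTo 1 (n + p) (λ k → F k (S (KnUpK1 n p) k)) ≡ ΣFromTo n (n + p) (λ k → F k (ΣFromTo 0 n (term n p k)))
ΣFromTo-S-KnUpK1 n p F F0≡0 1≤n = begin
  ΣFromTo 1 (n + p) (λ k → F k (S (KnUpK1 n p) k))
    ≡⟨ ΣFromTo-1-offset n p (λ k → F k (S (KnUpK1 n p) k)) 1≤n
         (λ k k<n → trans (cong (F k) (S-KnUpK1-below n p k<n)) (F0≡0 k)) ⟩
  ∑[ d < suc p ] F (n + toℕ d) (S (KnUpK1 n p) (n + toℕ d))
    ≡⟨ ∑-cong (suc p) (λ d _ → cong (F (n + d)) (S-KnUpK1 n p d)) ⟩
  ∑[ d < suc p ] F (n + toℕ d) (ΣFromTo 0 n (term n p (n + toℕ d)))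
    ≡⟨ ΣFromTo-offset n p (λ k → F k (ΣFromTo 0 n (term n p k))) ⟨
  ΣFromTo n (n + p) (λ k → F k (ΣFromTo 0 n (term n p k))) ∎
  where open ≡-Reasoning

proposition12 : (n p : ℕ) → n ≥ 1 →
    A (KnUpK1 n p) ≡
      ratio (ΣFromTo n (n + p) (λ k → k * ΣFromTo 0 n (λ j → term n p k j)))
            (ΣFromTo n (n + p) (λ k → ΣFromTo 0 n (λ j → term n p k j)))
proposition12 n p n≥1 =
  cong₂ ratio (ΣFromTo-S-KnUpK1 n p _*_ *-zeroʳ n≥1) (ΣFromTo-S-KnUpK1 n p (λ _ x → x) (λ _ → refl) n≥1)
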